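{- Fix an integer $n\ge 2$. For any prime $p\ge5$ with $p\equiv1\pmod n$, $$\left(1-\frac1n\right)_p\equiv(n-1)\left(\frac1n\right)_p\pmod{p^3}.$$
   Context: For $a\in\mathbb{Q}$ and $k\ge0$ an integer, $(a)_k=a(a+1)\cdots(a+k-1)$. For $x,y\in\mathbb{Q}_p$, $x\equiv y\pmod{p^m}$ means $v_p(x-y)\ge m$. -}

module Defs where

open import Data.Nat as ℕ using (ℕ; zero; suc)
open import Data.Integer as ℤ using (ℤ)
open import Data.Rational as ℚ using (ℚ; _+_; _*_; _-_)
open import Data.Nat.Divisibility using (_∣_)
open import Data.Product using (Σ; _×_)
open import Relation.Nullary using (¬_)
open import Relation.Binary.PropositionalEquality using (_≡_)

poch : ℚ → ℕ → ℚ
poch a zero    = ℚ.1ℚ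
poch a (suc k) = poch a k * (a + ((ℤ.+ k) ℚ./ 1))

-- x ≡ y (mod p^m) in ℚ_p restricted to ℚ: v_p(x - y) ≥ m, i.e.
-- x - y = p^m * (a / b) for some integers a, b with p ∤ b.
_≡_[modPow_^_] : ℚ → ℚ → ℕ → ℕ → Set
x ≡ y [modPow p ^ m ] =
  Σ ℤ λ a → Σ ℕ λ b → (¬ (p ∣ b)) ×
    (Σ (ℕ.NonZero b) λ nz → x - y ≡ ((ℤ.+ (p ℕ.^ m)) ℚ./ 1) * (ℚ._/_ a b {{nz}}))

nz≥2 : (n : ℕ) → n ℕ.≥ 2 → ℕ.NonZero n
nz≥2 (suc n) _ = _

module Submission where

-- Write b(x) = n x + 1, so that n^p (1/n)_p = ∏_{k<p} b(k), and reversing the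
-- order of the factors, n^p (1 - 1/n)_p = ∏_{k<p} (n p - b(k)).  With p - 1 = n m
-- and p = 1 + 2m + 2r (p is odd), the factor b(m) equals p, and the remaining
-- indices fall into pairs {x, 2m - x} (x < m) and {2m+1+x, 2m+2r-x} (x < r) whose
-- values b sum to a multiple of p.  For such a pair (u, v),
--   (n p - u)(n p - v) = u v + p² (n² - n (u + v)/p) ≡ u v  (mod p²),
-- while the unpaired factors are p and n p - p = (n - 1) p.  Hence
--   n^p (1 - 1/n)_p - (n - 1) n^p (1/n)_p = (n - 1) p (C - B)  with  C ≡ B (mod p²),
-- a multiple of p³; dividing by n^p, which is prime to p, gives the corollary.

open import Defs

module IntegerProducts where
  open import Data.Nat as ℕ using (ℕ; zero; suc)
  import Data.Nat.Properties as ℕ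
  open import Data.Integer using (ℤ; +_; 0ℤ; 1ℤ; _+_; _*_; _-_)
  open import Data.Integer.Properties using (*-identityʳ; *-comm; *-assoc; pos-*)
  open import Data.Integer.Divisibility.Signed
    using (_∣_; divides; ∣m∣n⇒∣m+n; ∣m⇒∣m*n; ∣n⇒∣m*n; *-monoʳ-∣)
  open import Data.Integer.Tactic.RingSolver using (solve-∀)
  open import Relation.Binary.PropositionalEquality
  open ≡-Reasoning

  ∏ : ℕ → (ℤ → ℤ) → ℤ
  ∏ zero    g = 1ℤ
  ∏ (suc h) g = ∏ h g * g (+ h)

  ∏-cong : ∀ h {f g : ℤ → ℤ} → (∀ x → f x ≡ g x) → ∏ h f ≡ ∏ h g
  ∏-cong zero    f≗g = refl
  ∏-cong (suc h) f≗g = cong₂ _*_ (∏-cong h f≗g) (f≗g (+ h))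

  ∏-* : ∀ h f g → ∏ h f * ∏ h g ≡ ∏ h (λ x → f x * g x)
  ∏-* zero    f g = refl
  ∏-* (suc h) f g = begin
    ∏ h f * f (+ h) * (∏ h g * g (+ h)) ≡⟨ interchange (∏ h f) (f (+ h)) (∏ h g) (g (+ h)) ⟩
    ∏ h f * ∏ h g * (f (+ h) * g (+ h)) ≡⟨ cong (_* (f (+ h) * g (+ h))) (∏-* h f g) ⟩
    ∏ h (λ x → f x * g x) * (f (+ h) * g (+ h)) ∎
    where
    interchange : ∀ a x b y → a * x * (b * y) ≡ a * b * (x * y)
    interchange = solve-∀

  ∏-split : ∀ k l g → ∏ (k ℕ.+ l) g ≡ ∏ k g * ∏ l (λ x → g (+ k + x))
  ∏-split k zero    g rewrite ℕ.+-identityʳ k = sym (*-identityʳ (∏ k g))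
  ∏-split k (suc l) g rewrite ℕ.+-suc k l = begin
    ∏ (k ℕ.+ l) g * g (+ (k ℕ.+ l))               ≡⟨ cong (_* g (+ (k ℕ.+ l))) (∏-split k l g) ⟩
    ∏ k g * ∏ l (λ x → g (+ k + x)) * g (+ k + + l) ≡⟨ *-assoc (∏ k g) _ _ ⟩
    ∏ k g * (∏ l (λ x → g (+ k + x)) * g (+ k + + l)) ∎

  ∏-first : ∀ h g → ∏ (suc h) g ≡ g 0ℤ * ∏ h (λ x → g (1ℤ + x))
  ∏-first h g = trans (∏-split 1 h g) (cong (_* ∏ h (λ x → g (1ℤ + x))) (one-left (g 0ℤ)))
    where
    one-left : ∀ a → 1ℤ * a ≡ a
    one-left = solve-∀

  ∏-reverse : ∀ h g → ∏ h g ≡ ∏ h (λ x → g (+ h - 1ℤ - x))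
  ∏-reverse zero    g = refl
  ∏-reverse (suc h) g = begin
    ∏ (suc h) g                                   ≡⟨ ∏-first h g ⟩
    g 0ℤ * ∏ h (λ x → g (1ℤ + x))                 ≡⟨ cong (g 0ℤ *_) (∏-reverse h (λ x → g (1ℤ + x))) ⟩
    g 0ℤ * ∏ h (λ x → g (1ℤ + (+ h - 1ℤ - x)))    ≡⟨ *-comm (g 0ℤ) _ ⟩
    ∏ h (λ x → g (1ℤ + (+ h - 1ℤ - x))) * g 0ℤ    ≡⟨ cong₂ _*_ (∏-cong h (λ x → cong g (shift (+ h) x))) (cong g (last (+ h))) ⟩
    ∏ h (λ x → g (+ suc h - 1ℤ - x)) * g (+ suc h - 1ℤ - + h) ∎
    where
    shift : ∀ h x → 1ℤ + (h - 1ℤ - x) ≡ 1ℤ + h - 1ℤ - x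
    shift = solve-∀
    last : ∀ h → 0ℤ ≡ 1ℤ + h - 1ℤ - h
    last = solve-∀

  mirror : ℤ → (ℤ → ℤ) → ℤ → ℤ
  mirror s g x = g x * g (s - x)

  ∏-pair : ∀ h c g → ∏ h g * ∏ h (λ x → g (c + x)) ≡ ∏ h (λ x → g x * g (c + (+ h - 1ℤ - x)))
  ∏-pair h c g = trans (cong (∏ h g *_) (∏-reverse h (λ x → g (c + x)))) (∏-* h g _)

  ∏-fold-even : ∀ h g → ∏ (h ℕ.+ h) g ≡ ∏ h (mirror (+ h + + h - 1ℤ) g)
  ∏-fold-even h g = begin
    ∏ (h ℕ.+ h) g                                       ≡⟨ ∏-split h h g ⟩
    ∏ h g * ∏ h (λ x → g (+ h + x))                      ≡⟨ ∏-pair h (+ h) g ⟩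
    ∏ h (λ x → g x * g (+ h + (+ h - 1ℤ - x)))           ≡⟨ ∏-cong h (λ x → cong (λ y → g x * g y) (reassoc (+ h) x)) ⟩
    ∏ h (mirror (+ h + + h - 1ℤ) g) ∎
    where
    reassoc : ∀ h x → h + (h - 1ℤ - x) ≡ h + h - 1ℤ - x
    reassoc = solve-∀

  ∏-fold-odd : ∀ h g → ∏ (suc (h ℕ.+ h)) g ≡ g (+ h) * ∏ h (mirror (+ h + + h) g)
  ∏-fold-odd h g = begin
    ∏ (suc (h ℕ.+ h)) g                                         ≡⟨ cong (λ k → ∏ k g) (sym (ℕ.+-suc h h)) ⟩
    ∏ (h ℕ.+ suc h) g                                           ≡⟨ ∏-split h (suc h) g ⟩
    ∏ h g * ∏ (suc h) (λ x → g (+ h + x))                        ≡⟨ cong (∏ h g *_) (∏-first h (λ x → g (+ h + x))) ⟩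
    ∏ h g * (g (+ h + 0ℤ) * ∏ h (λ x → g (+ h + (1ℤ + x))))      ≡⟨ rotate (∏ h g) (g (+ h + 0ℤ)) _ ⟩
    g (+ h + 0ℤ) * (∏ h g * ∏ h (λ x → g (+ h + (1ℤ + x))))      ≡⟨ cong₂ (λ a b → g a * (∏ h g * b)) (right-unit (+ h)) (∏-cong h (λ x → cong g (assoc (+ h) x))) ⟩
    g (+ h) * (∏ h g * ∏ h (λ x → g (+ h + 1ℤ + x)))            ≡⟨ cong (g (+ h) *_) (∏-pair h (+ h + 1ℤ) g) ⟩
    g (+ h) * ∏ h (λ x → g x * g (+ h + 1ℤ + (+ h - 1ℤ - x)))    ≡⟨ cong (g (+ h) *_) (∏-cong h (λ x → cong (λ y → g x * g y) (reassoc (+ h) x))) ⟩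
    g (+ h) * ∏ h (mirror (+ h + + h) g) ∎
    where
    rotate : ∀ a b c → a * (b * c) ≡ b * (a * c)
    rotate = solve-∀
    right-unit : ∀ a → a + 0ℤ ≡ a
    right-unit = solve-∀
    assoc : ∀ h x → h + (1ℤ + x) ≡ h + 1ℤ + x
    assoc = solve-∀
    reassoc : ∀ h x → h + 1ℤ + (h - 1ℤ - x) ≡ h + h - x
    reassoc = solve-∀

  ∏-decompose : ∀ m r g → ∏ (suc (m ℕ.+ m) ℕ.+ (r ℕ.+ r)) g ≡
    g (+ m) * (∏ m (mirror (+ m + + m) g) * ∏ r (mirror (+ r + + r - 1ℤ) (λ x → g (+ suc (m ℕ.+ m) + x))))
  ∏-decompose m r g = begin
    ∏ (suc (m ℕ.+ m) ℕ.+ (r ℕ.+ r)) g                          ≡⟨ ∏-split (suc (m ℕ.+ m)) (r ℕ.+ r) g ⟩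
    ∏ (suc (m ℕ.+ m)) g * ∏ (r ℕ.+ r) g'                        ≡⟨ cong₂ _*_ (∏-fold-odd m g) (∏-fold-even r g') ⟩
    g (+ m) * ∏ m (mirror (+ m + + m) g) * ∏ r (mirror (+ r + + r - 1ℤ) g') ≡⟨ *-assoc (g (+ m)) _ _ ⟩
    g (+ m) * (∏ m (mirror (+ m + + m) g) * ∏ r (mirror (+ r + + r - 1ℤ) g')) ∎
    where
    g' : ℤ → ℤ
    g' x = g (+ suc (m ℕ.+ m) + x)

  infix 4 _≡_[mod_]
  _≡_[mod_] : ℤ → ℤ → ℤ → Set
  x ≡ y [mod q ] = q ∣ x - y

  *-cong-mod : ∀ {q x x' y y'} → x ≡ x' [mod q ] → y ≡ y' [mod q ] → x * y ≡ x' * y' [mod q ]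
  *-cong-mod {q} {x} {x'} {y} {y'} x≡x' y≡y' =
    subst (q ∣_) (expand x x' y y') (∣m∣n⇒∣m+n (∣m⇒∣m*n y x≡x') (∣n⇒∣m*n x' y≡y'))
    where
    expand : ∀ x x' y y' → (x - x') * y + x' * (y - y') ≡ x * y - x' * y'
    expand = solve-∀

  ∏-cong-mod : ∀ {q} h {f g} → (∀ x → f x ≡ g x [mod q ]) → ∏ h f ≡ ∏ h g [mod q ]
  ∏-cong-mod zero    f≡g = divides 0ℤ refl
  ∏-cong-mod (suc h) {f} {g} f≡g =
    *-cong-mod {x = ∏ h f} {∏ h g} {f (+ h)} {g (+ h)} (∏-cong-mod h f≡g) (f≡g (+ h))

  Antisymmetric : ℤ → ℤ → (ℤ → ℤ) → Set
  Antisymmetric P s g = ∀ x → P ∣ g x + g (s - x)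

  reflect-pair : ∀ N {P u v} → P ∣ u + v → (N * P - u) * (N * P - v) ≡ u * v [mod P * P ]
  reflect-pair N {P} {u} {v} (divides t u+v≡tP) = divides (N * N - N * t) (begin
    (N * P - u) * (N * P - v) - u * v   ≡⟨ expand N P u v ⟩
    N * N * (P * P) - N * P * (u + v)   ≡⟨ cong (λ w → N * N * (P * P) - N * P * w) u+v≡tP ⟩
    N * N * (P * P) - N * P * (t * P)   ≡⟨ factor N P t ⟩
    (N * N - N * t) * (P * P)           ∎)
    where
    expand : ∀ N P u v → (N * P - u) * (N * P - v) - u * v ≡ N * N * (P * P) - N * P * (u + v)
    expand = solve-∀
    factor : ∀ N P t → N * N * (P * P) - N * P * (t * P) ≡ (N * N - N * t) * (P * P)
    factor = solve-∀

  -- The midpoint factor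
  -- becomes (N - 1) P, and each pair of factors is unchanged modulo P² by reflect-pair.
  reflection-congruence : ∀ N P b m r → b (+ m) ≡ P →
    Antisymmetric P (+ m + + m) b →
    Antisymmetric P (+ r + + r - 1ℤ) (λ x → b (+ suc (m ℕ.+ m) + x)) →
    ∏ (suc (m ℕ.+ m) ℕ.+ (r ℕ.+ r)) (λ x → N * P - b x) ≡
      (N - 1ℤ) * ∏ (suc (m ℕ.+ m) ℕ.+ (r ℕ.+ r)) b [mod P * (P * P) ]
  reflection-congruence N P b m r bm≡P anti₁ anti₂ =
    subst (P * (P * P) ∣_) (sym difference) (∣n⇒∣m*n (N - 1ℤ) (*-monoʳ-∣ P pairs-agree))
    where
    p = suc (m ℕ.+ m) ℕ.+ (r ℕ.+ r)
    s₁ = + m + + m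
    s₂ = + r + + r - 1ℤ
    a = + suc (m ℕ.+ m)
    c : ℤ → ℤ
    c x = N * P - b x
    C = ∏ m (mirror s₁ c) * ∏ r (mirror s₂ (λ x → c (a + x)))
    B = ∏ m (mirror s₁ b) * ∏ r (mirror s₂ (λ x → b (a + x)))
    pairs-agree : C ≡ B [mod P * P ]
    pairs-agree = *-cong-mod {x = ∏ m (mirror s₁ c)} {∏ m (mirror s₁ b)}
      (∏-cong-mod m (λ x → reflect-pair N (anti₁ x)))
      (∏-cong-mod r (λ x → reflect-pair N (anti₂ x)))
    difference : ∏ p c - (N - 1ℤ) * ∏ p b ≡ (N - 1ℤ) * (P * (C - B))
    difference = begin
      ∏ p c - (N - 1ℤ) * ∏ p b                       ≡⟨ cong₂ (λ u v → u - (N - 1ℤ) * v) (∏-decompose m r c) (∏-decompose m r b) ⟩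
      (N * P - b (+ m)) * C - (N - 1ℤ) * (b (+ m) * B) ≡⟨ cong (λ w → (N * P - w) * C - (N - 1ℤ) * (w * B)) bm≡P ⟩
      (N * P - P) * C - (N - 1ℤ) * (P * B)             ≡⟨ factor N P C B ⟩
      (N - 1ℤ) * (P * (C - B))                         ∎
      where
      factor : ∀ N P C B → (N * P - P) * C - (N - 1ℤ) * (P * B) ≡ (N - 1ℤ) * (P * (C - B))
      factor = solve-∀

  -- The case b x = n x + 1 with p = 1 + n m = 1 + 2m + 2r: here b m = p, and the pair
  -- sums are n (2m) + 2 = 2p and n (4m + 2r + 1) + 2 = (n + 2) p.
  affine-congruence : ∀ n m r p → p ≡ suc (m ℕ.+ m) ℕ.+ (r ℕ.+ r) → p ≡ suc (n ℕ.* m) →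
    ∏ p (λ x → + n * + p - (+ n * x + 1ℤ)) ≡ (+ n - 1ℤ) * ∏ p (λ x → + n * x + 1ℤ) [mod + p * (+ p * + p) ]
  affine-congruence n m r .(suc (m ℕ.+ m) ℕ.+ (r ℕ.+ r)) refl p≡1+nm =
    reflection-congruence N P b m r b[m]≡P anti₁ anti₂
    where
    N = + n
    M = + m
    R = + r
    P = + (suc (m ℕ.+ m) ℕ.+ (r ℕ.+ r))
    b : ℤ → ℤ
    b x = N * x + 1ℤ
    b[m]≡P : N * M + 1ℤ ≡ P
    b[m]≡P = trans (cong (_+ 1ℤ) (sym (pos-* n m))) (cong +_ (trans (ℕ.+-comm (n ℕ.* m) 1) (sym p≡1+nm)))
    anti₁ : Antisymmetric P (M + M) b
    anti₁ x = divides (+ 2) (begin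
      b x + b (M + M - x)   ≡⟨ pair-sum N M x ⟩
      + 2 * (N * M + 1ℤ)    ≡⟨ cong (+ 2 *_) b[m]≡P ⟩
      + 2 * P               ∎)
      where
      pair-sum : ∀ N M x → N * x + 1ℤ + (N * (M + M - x) + 1ℤ) ≡ + 2 * (N * M + 1ℤ)
      pair-sum = solve-∀
    anti₂ : Antisymmetric P (R + R - 1ℤ) (λ x → b (+ suc (m ℕ.+ m) + x))
    anti₂ x = divides (N + + 2) (begin
      b (1ℤ + (M + M) + x) + b (1ℤ + (M + M) + (R + R - 1ℤ - x)) ≡⟨ pair-sum N M R x ⟩
      N * P + + 2 * (N * M + 1ℤ)                                 ≡⟨ cong (λ w → N * P + + 2 * w) b[m]≡P ⟩
      N * P + + 2 * P                                            ≡⟨ factor N P ⟩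
      (N + + 2) * P                                              ∎)
      where
      pair-sum : ∀ N M R x → N * (1ℤ + (M + M) + x) + 1ℤ + (N * (1ℤ + (M + M) + (R + R - 1ℤ - x)) + 1ℤ)
                             ≡ N * (1ℤ + (M + M) + (R + R)) + + 2 * (N * M + 1ℤ)
      pair-sum = solve-∀
      factor : ∀ N P → N * P + + 2 * P ≡ (N + + 2) * P
      factor = solve-∀

  ∏-reflect-affine : ∀ n p → ∏ p (λ x → + n * x + (+ n - 1ℤ)) ≡ ∏ p (λ x → + n * + p - (+ n * x + 1ℤ))
  ∏-reflect-affine n p = trans (∏-reverse p _) (∏-cong p (reflect (+ n) (+ p)))
    where
    reflect : ∀ N P x → N * (P - 1ℤ - x) + (N - 1ℤ) ≡ N * P - (N * x + 1ℤ)
    reflect = solve-∀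

  pos-cube : ∀ p → + (p ℕ.^ 3) ≡ + p * (+ p * + p)
  pos-cube p = begin
    + (p ℕ.* (p ℕ.* (p ℕ.* 1)))    ≡⟨ pos-* p _ ⟩
    + p * + (p ℕ.* (p ℕ.* 1))      ≡⟨ cong (+ p *_) (pos-* p _) ⟩
    + p * (+ p * + (p ℕ.* 1))      ≡⟨ cong (λ w → + p * (+ p * + w)) (ℕ.*-identityʳ p) ⟩
    + p * (+ p * + p)              ∎

  integer-congruence : ∀ n m r p → p ≡ suc (m ℕ.+ m) ℕ.+ (r ℕ.+ r) → p ≡ suc (n ℕ.* m) →
    ∏ p (λ x → + n * x + (+ n - 1ℤ)) ≡ (+ n - 1ℤ) * ∏ p (λ x → + n * x + 1ℤ) [mod + (p ℕ.^ 3) ]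
  integer-congruence n m r p p≡1+2m+2r p≡1+nm =
    subst₂ (λ A q → A ≡ (+ n - 1ℤ) * ∏ p (λ x → + n * x + 1ℤ) [mod q ])
      (sym (∏-reflect-affine n p)) (sym (pos-cube p))
      (affine-congruence n m r p p≡1+2m+2r p≡1+nm)

module RationalEmbedding where
  open import Data.Nat as ℕ using (ℕ; suc)
  import Data.Nat.Properties as ℕ
  open import Data.Nat.Divisibility using (_∣_)
  open import Data.Integer as ℤ using (ℤ; +_)
  import Data.Integer.Properties as ℤ
  open import Data.Integer.Divisibility.Signed using (divides) renaming (_∣_ to _∣ℤ_)
  open import Data.Rational using (ℚ; _+_; _*_; _-_; -_; 1ℚ; _/_; toℚᵘ)
  open import Data.Rational.Properties
    using (toℚᵘ-injective; toℚᵘ-fromℚᵘ; toℚᵘ-homo-+; toℚᵘ-homo-*; toℚᵘ-homo‿-; *-identityʳ; *-assoc)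
  import Data.Rational.Unnormalised as ℚᵘ
  open import Data.Rational.Unnormalised.Properties using (≃-sym; +-cong; *-cong; -‿cong; module ≃-Reasoning)
  open import Data.Rational.Solver using (module +-*-Solver)
  open import Data.Product using (_,_)
  open import Relation.Nullary using (¬_)
  open import Relation.Binary.PropositionalEquality
  open IntegerProducts using (∏)

  -- The embedding ℤ → ℚ, written z / 1 as in the definition of poch.  Its ring
  -- homomorphism properties are checked in the unnormalised rationals.
  ι : ℤ → ℚ
  ι z = z / 1

  toℚᵘ-/ : ∀ z k → toℚᵘ (z / suc k) ℚᵘ.≃ ℚᵘ.mkℚᵘ z k
  toℚᵘ-/ z k = toℚᵘ-fromℚᵘ (ℚᵘ.mkℚᵘ z k)

  ι-+ : ∀ x y → ι (x ℤ.+ y) ≡ ι x + ι y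
  ι-+ x y = toℚᵘ-injective (begin
    toℚᵘ (ι (x ℤ.+ y))              ≈⟨ toℚᵘ-/ (x ℤ.+ y) 0 ⟩
    ℚᵘ.mkℚᵘ (x ℤ.+ y) 0             ≈⟨ ℚᵘ.*≡* (cross-multiply x y) ⟩
    ℚᵘ.mkℚᵘ x 0 ℚᵘ.+ ℚᵘ.mkℚᵘ y 0    ≈⟨ +-cong (≃-sym (toℚᵘ-/ x 0)) (≃-sym (toℚᵘ-/ y 0)) ⟩
    toℚᵘ (ι x) ℚᵘ.+ toℚᵘ (ι y)      ≈⟨ ≃-sym (toℚᵘ-homo-+ (ι x) (ι y)) ⟩
    toℚᵘ (ι x + ι y)                ∎)
    where
    open ≃-Reasoning
    cross-multiply : ∀ x y → (x ℤ.+ y) ℤ.* + 1 ≡ (x ℤ.* + 1 ℤ.+ y ℤ.* + 1) ℤ.* + 1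
    cross-multiply x y = cong (ℤ._* + 1) (cong₂ ℤ._+_ (sym (ℤ.*-identityʳ x)) (sym (ℤ.*-identityʳ y)))

  ι-* : ∀ x y → ι (x ℤ.* y) ≡ ι x * ι y
  ι-* x y = toℚᵘ-injective (begin
    toℚᵘ (ι (x ℤ.* y))              ≈⟨ toℚᵘ-/ (x ℤ.* y) 0 ⟩
    ℚᵘ.mkℚᵘ (x ℤ.* y) 0             ≈⟨ *-cong (≃-sym (toℚᵘ-/ x 0)) (≃-sym (toℚᵘ-/ y 0)) ⟩
    toℚᵘ (ι x) ℚᵘ.* toℚᵘ (ι y)      ≈⟨ ≃-sym (toℚᵘ-homo-* (ι x) (ι y)) ⟩
    toℚᵘ (ι x * ι y)                ∎)
    where
    open ≃-Reasoning

  ι-neg : ∀ x → ι (ℤ.- x) ≡ - ι x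
  ι-neg x = toℚᵘ-injective (begin
    toℚᵘ (ι (ℤ.- x))     ≈⟨ toℚᵘ-/ (ℤ.- x) 0 ⟩
    ℚᵘ.mkℚᵘ (ℤ.- x) 0    ≈⟨ -‿cong (≃-sym (toℚᵘ-/ x 0)) ⟩
    ℚᵘ.- toℚᵘ (ι x)      ≈⟨ ≃-sym (toℚᵘ-homo‿- (ι x)) ⟩
    toℚᵘ (- ι x)         ∎)
    where
    open ≃-Reasoning

  ι-- : ∀ x y → ι (x ℤ.- y) ≡ ι x - ι y
  ι-- x y = trans (ι-+ x (ℤ.- y)) (cong (λ w → ι x + w) (ι-neg y))

  /-as-* : ∀ z d .{{_ : ℕ.NonZero d}} → z / d ≡ ι z * (+ 1 / d)
  /-as-* z (suc k) = toℚᵘ-injective (begin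
    toℚᵘ (z / suc k)                          ≈⟨ toℚᵘ-/ z k ⟩
    ℚᵘ.mkℚᵘ z k                               ≈⟨ ℚᵘ.*≡* cross-multiply ⟩
    ℚᵘ.mkℚᵘ z 0 ℚᵘ.* ℚᵘ.mkℚᵘ (+ 1) k          ≈⟨ *-cong (≃-sym (toℚᵘ-/ z 0)) (≃-sym (toℚᵘ-/ (+ 1) k)) ⟩
    toℚᵘ (ι z) ℚᵘ.* toℚᵘ (+ 1 / suc k)        ≈⟨ ≃-sym (toℚᵘ-homo-* (ι z) (+ 1 / suc k)) ⟩
    toℚᵘ (ι z * (+ 1 / suc k))                ∎)
    where
    open ≃-Reasoning
    cross-multiply : z ℤ.* + suc (k ℕ.+ 0) ≡ (z ℤ.* + 1) ℤ.* + suc k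
    cross-multiply = trans (cong (λ w → z ℤ.* + suc w) (ℕ.+-identityʳ k))
                           (cong (ℤ._* + suc k) (sym (ℤ.*-identityʳ z)))

  ι-inverse : ∀ d .{{_ : ℕ.NonZero d}} → ι (+ d) * (+ 1 / d) ≡ 1ℚ
  ι-inverse d = trans (sym (/-as-* (+ d) d)) (d/d≡1 d)
    where
    d/d≡1 : ∀ d .{{_ : ℕ.NonZero d}} → + d / d ≡ 1ℚ
    d/d≡1 (suc k) = toℚᵘ-injective (begin
      toℚᵘ (+ suc k / suc k)    ≈⟨ toℚᵘ-/ (+ suc k) k ⟩
      ℚᵘ.mkℚᵘ (+ suc k) k       ≈⟨ ℚᵘ.*≡* (ℤ.*-comm (+ suc k) (+ 1)) ⟩
      ℚᵘ.mkℚᵘ (+ 1) 0           ≈⟨ ≃-sym (toℚᵘ-/ (+ 1) 0) ⟩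
      toℚᵘ 1ℚ                   ∎)
      where
      open ≃-Reasoning

  poch-clear : ∀ n q (g : ℤ → ℤ) → (∀ k → (q + ι (+ k)) * ι (+ n) ≡ ι (g (+ k))) →
    ∀ k → poch q k * ι (+ (n ℕ.^ k)) ≡ ι (∏ k g)
  poch-clear n q g clear ℕ.zero  = *-identityʳ 1ℚ
  poch-clear n q g clear (suc k) = begin
    poch q k * Q * ι (+ (n ℕ.* n ℕ.^ k))         ≡⟨ cong (λ w → poch q k * Q * ι w) (ℤ.pos-* n (n ℕ.^ k)) ⟩
    poch q k * Q * ι (+ n ℤ.* + (n ℕ.^ k))       ≡⟨ cong (λ w → poch q k * Q * w) (ι-* (+ n) (+ (n ℕ.^ k))) ⟩
    poch q k * Q * (ι (+ n) * ι (+ (n ℕ.^ k)))   ≡⟨ regroup (poch q k) Q (ι (+ n)) (ι (+ (n ℕ.^ k))) ⟩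
    poch q k * ι (+ (n ℕ.^ k)) * (Q * ι (+ n))   ≡⟨ cong₂ _*_ (poch-clear n q g clear k) (clear k) ⟩
    ι (∏ k g) * ι (g (+ k))                      ≡⟨ sym (ι-* (∏ k g) (g (+ k))) ⟩
    ι (∏ k g ℤ.* g (+ k))                        ∎
    where
    open ≡-Reasoning
    open +-*-Solver
    Q = q + ι (+ k)
    regroup : ∀ a b c d → a * b * (c * d) ≡ a * d * (b * c)
    regroup = solve 4 (λ a b c d → a :* b :* (c :* d) := a :* d :* (b :* c)) refl

  clear-1/n : ∀ n .{{_ : ℕ.NonZero n}} k → (+ 1 / n + ι (+ k)) * ι (+ n) ≡ ι (+ n ℤ.* + k ℤ.+ ℤ.1ℤ)
  clear-1/n n k = begin
    (u + K) * N              ≡⟨ expand u K N ⟩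
    N * K + N * u            ≡⟨ cong (λ w → N * K + w) (ι-inverse n) ⟩
    N * K + 1ℚ               ≡⟨ cong (_+ 1ℚ) (sym (ι-* (+ n) (+ k))) ⟩
    ι (+ n ℤ.* + k) + 1ℚ     ≡⟨ sym (ι-+ (+ n ℤ.* + k) ℤ.1ℤ) ⟩
    ι (+ n ℤ.* + k ℤ.+ ℤ.1ℤ) ∎
    where
    open ≡-Reasoning
    open +-*-Solver
    u = + 1 / n
    K = ι (+ k)
    N = ι (+ n)
    expand : ∀ u K N → (u + K) * N ≡ N * K + N * u
    expand = solve 3 (λ u K N → (u :+ K) :* N := N :* K :+ N :* u) refl

  clear-1-1/n : ∀ n .{{_ : ℕ.NonZero n}} k →
    (1ℚ - + 1 / n + ι (+ k)) * ι (+ n) ≡ ι (+ n ℤ.* + k ℤ.+ (+ n ℤ.- ℤ.1ℤ))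
  clear-1-1/n n k = begin
    (1ℚ - u + K) * N                    ≡⟨ expand u K N ⟩
    N * K + (N - N * u)                 ≡⟨ cong (λ w → N * K + (N - w)) (ι-inverse n) ⟩
    N * K + (N - 1ℚ)                    ≡⟨ cong₂ _+_ (sym (ι-* (+ n) (+ k))) (sym (ι-- (+ n) ℤ.1ℤ)) ⟩
    ι (+ n ℤ.* + k) + ι (+ n ℤ.- ℤ.1ℤ)  ≡⟨ sym (ι-+ (+ n ℤ.* + k) (+ n ℤ.- ℤ.1ℤ)) ⟩
    ι (+ n ℤ.* + k ℤ.+ (+ n ℤ.- ℤ.1ℤ))  ∎
    where
    open ≡-Reasoning
    open +-*-Solver
    u = + 1 / n
    K = ι (+ k)
    N = ι (+ n)
    expand : ∀ u K N → (1ℚ - u + K) * N ≡ N * K + (N - N * u)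
    expand = solve 3 (λ u K N → (con 1ℚ :- u :+ K) :* N := N :* K :+ (N :- N :* u)) refl

  scale-cleared : ∀ c x D X → x * D ≡ ι X → ι c * x * D ≡ ι (c ℤ.* X)
  scale-cleared c x D X xD≡X = begin
    ι c * x * D     ≡⟨ *-assoc (ι c) x D ⟩
    ι c * (x * D)   ≡⟨ cong (ι c *_) xD≡X ⟩
    ι c * ι X       ≡⟨ sym (ι-* c X) ⟩
    ι (c ℤ.* X)     ∎
    where
    open ≡-Reasoning

  -- Passing from integers to rationals: if d x = X and d y = Y with p ∤ d, then
  -- p^k ∣ X - Y means x ≡ y (mod p^k), witnessed by x - y = p^k · (X - Y)/(p^k d).
  clear-denominator : ∀ p k d {{_ : ℕ.NonZero d}} (x y : ℚ) (X Y : ℤ) → ¬ (p ∣ d) →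
    x * ι (+ d) ≡ ι X → y * ι (+ d) ≡ ι Y → + (p ℕ.^ k) ∣ℤ X ℤ.- Y → x ≡ y [modPow p ^ k ]
  clear-denominator p k d {{nz}} x y X Y p∤d xd≡X yd≡Y (divides q X-Y≡q*pᵏ) =
    q , d , p∤d , nz , (begin
      x - y                             ≡⟨ sym (*-identityʳ (x - y)) ⟩
      (x - y) * 1ℚ                      ≡⟨ cong ((x - y) *_) (sym (ι-inverse d)) ⟩
      (x - y) * (D * d⁻¹)               ≡⟨ distribute x y D d⁻¹ ⟩
      (x * D - y * D) * d⁻¹             ≡⟨ cong₂ (λ a b → (a - b) * d⁻¹) xd≡X yd≡Y ⟩
      (ι X - ι Y) * d⁻¹                 ≡⟨ cong (_* d⁻¹) (sym (ι-- X Y)) ⟩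
      ι (X ℤ.- Y) * d⁻¹                 ≡⟨ cong (λ w → ι w * d⁻¹) X-Y≡q*pᵏ ⟩
      ι (q ℤ.* pᵏ) * d⁻¹                ≡⟨ cong (_* d⁻¹) (ι-* q pᵏ) ⟩
      ι q * ι pᵏ * d⁻¹                  ≡⟨ reorder (ι q) (ι pᵏ) d⁻¹ ⟩
      ι pᵏ * (ι q * d⁻¹)                ≡⟨ cong (ι pᵏ *_) (sym (/-as-* q d)) ⟩
      ι pᵏ * (q / d)                    ∎)
    where
    open ≡-Reasoning
    open +-*-Solver
    D = ι (+ d)
    d⁻¹ = + 1 / d
    pᵏ = + (p ℕ.^ k)
    distribute : ∀ x y D e → (x - y) * (D * e) ≡ (x * D - y * D) * e
    distribute = solve 4 (λ x y D e → (x :- y) :* (D :* e) := (x :* D :- y :* D) :* e) refl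
    reorder : ∀ a b c → a * b * c ≡ b * (a * c)
    reorder = solve 3 (λ a b c → a :* b :* c := b :* (a :* c)) refl

module PrimeExponent where
  open import Data.Nat as ℕ using (ℕ; zero; suc; _+_; _*_; _∸_; _^_; _≤_; _<_; s≤s)
  import Data.Nat.Properties as ℕ
  open import Data.Nat.Divisibility using (_∣_; divides; ∣1⇒≡1)
  open import Data.Nat.Primality using (Prime; prime⇒nonZero; prime⇒nonTrivial; prime⇒¬composite; composite-≢)
  open import Data.Nat.Coprimality using (coprime-divisor; prime⇒coprime)
  open import Data.Nat.Tactic.RingSolver using (solve-∀)
  open import Data.Product using (Σ; _,_)
  open import Data.Sum using (_⊎_; inj₁; inj₂)
  open import Data.Empty using (⊥-elim)
  open import Function using (_∘_)
  open import Relation.Nullary using (¬_)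
  open import Relation.Binary.PropositionalEquality

  halve : ∀ k → Σ ℕ λ t → k ≡ t + t ⊎ k ≡ suc (t + t)
  halve zero    = 0 , inj₁ refl
  halve (suc k) with halve k
  ... | t , inj₁ k≡2t   = t , inj₂ (cong suc k≡2t)
  ... | t , inj₂ k≡2t+1 = suc t , inj₁ (cong suc (trans k≡2t+1 (sym (ℕ.+-suc t t))))

  odd-prime : ∀ {p} → Prime p → p ≢ 2 → Σ ℕ λ t → p ≡ suc (t + t)
  odd-prime {p} p-prime p≢2 with halve p
  ... | t , inj₂ p≡2t+1 = t , p≡2t+1
  ... | t , inj₁ p≡2t   = ⊥-elim (prime⇒¬composite p-prime (composite-≢ 2 (p≢2 ∘ sym) 2∣p))
    where
    instance _ = prime⇒nonZero p-prime
    2∣p : 2 ∣ p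
    2∣p = divides t (trans p≡2t (double t))
      where
      double : ∀ t → t + t ≡ t * 2
      double = solve-∀

  exponent-split : ∀ {n m p} → 2 ≤ n → Prime p → p ≢ 2 → p ≡ suc (n * m) →
    Σ ℕ λ r → p ≡ suc (m + m) + (r + r)
  exponent-split {n} {m} {p} n≥2 p-prime p≢2 p≡1+nm with odd-prime p-prime p≢2
  ... | t , p≡1+2t = t ∸ m , (begin
    p                                  ≡⟨ p≡1+2t ⟩
    suc (t + t)                        ≡⟨ cong (λ u → suc (u + u)) (sym (ℕ.m+[n∸m]≡n m≤t)) ⟩
    suc ((m + (t ∸ m)) + (m + (t ∸ m))) ≡⟨ regroup m (t ∸ m) ⟩
    suc (m + m) + ((t ∸ m) + (t ∸ m))  ∎)
    where
    open ≡-Reasoning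
    regroup : ∀ m r → suc ((m + r) + (m + r)) ≡ suc (m + m) + (r + r)
    regroup = solve-∀
    nm≡2t : n * m ≡ t + t
    nm≡2t = ℕ.suc-injective (trans (sym p≡1+nm) p≡1+2t)
    m≤t : m ≤ t
    m≤t = ℕ.*-cancelˡ-≤ 2 (ℕ.≤-trans (ℕ.*-monoˡ-≤ m n≥2)
            (ℕ.≤-reflexive (trans nm≡2t (cong (t +_) (sym (ℕ.+-identityʳ t))))))

  divisor-bound : ∀ {n m p} → Prime p → p ≡ suc (n * m) → n < p
  divisor-bound {n} {zero}  p-prime p≡1+nm =
    ⊥-elim (ℕ.nonTrivial⇒≢1 {{prime⇒nonTrivial p-prime}} (trans p≡1+nm (cong suc (ℕ.*-zeroʳ n))))
  divisor-bound {n} {suc m} p-prime p≡1+nm =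
    subst (n <_) (sym p≡1+nm) (s≤s (ℕ.m≤m*n n (suc m)))

  prime∤power : ∀ {p n} → Prime p → .{{_ : ℕ.NonZero n}} → n < p → ∀ k → ¬ (p ∣ n ^ k)
  prime∤power p-prime n<p zero    p∣1 =
    ℕ.nonTrivial⇒≢1 {{prime⇒nonTrivial p-prime}} (∣1⇒≡1 p∣1)
  prime∤power p-prime n<p (suc k) p∣nᵏ⁺¹ =
    prime∤power p-prime n<p k (coprime-divisor (prime⇒coprime p-prime n<p) p∣nᵏ⁺¹)

open import Data.Nat using (ℕ; _≥_; _∸_)
open import Data.Nat.Divisibility using (_∣_)
open import Data.Nat.Primality using (Prime)
open import Data.Integer using (+_)
open import Data.Rational using (ℚ; _*_; _-_; 1ℚ; _/_)

import Data.Nat as ℕ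
import Data.Nat.Properties as ℕ
open import Data.Nat.Divisibility using (divides)
import Data.Integer as ℤ
import Data.Integer.Properties as ℤ
open import Data.Product using (Σ; _,_)
open import Relation.Binary.PropositionalEquality
open IntegerProducts using (∏; integer-congruence)
open RationalEmbedding
open PrimeExponent

corollary2p16 : (n : ℕ) → (n≥2 : n ≥ 2) → (p : ℕ) → Prime p → p ≥ 5 → n ∣ p ∸ 1 →
    let instance _ = nz≥2 n n≥2 in
      poch (1ℚ - (+ 1 / n)) p ≡ (+ (n ∸ 1) / 1) * poch (+ 1 / n) p [modPow p ^ 3 ]
corollary2p16 n n≥2 p p-prime p≥5 (divides m p∸1≡mn) =
  conclude (exponent-split n≥2 p-prime p≢2 p≡1+nm)
  where
  instance
    _ = nz≥2 n n≥2
    _ = ℕ.m^n≢0 n p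
  p≢2 : p ≢ 2
  p≢2 = ℕ.>⇒≢ (ℕ.≤-trans (ℕ.s≤s (ℕ.s≤s (ℕ.s≤s ℕ.z≤n))) p≥5)
  p≡1+nm : p ≡ ℕ.suc (n ℕ.* m)
  p≡1+nm = trans (sym (ℕ.m+[n∸m]≡n (ℕ.≤-trans (ℕ.s≤s ℕ.z≤n) p≥5))) (cong ℕ.suc (trans p∸1≡mn (ℕ.*-comm m n)))
  n∸1≡n-1 : + (n ∸ 1) ≡ + n ℤ.- ℤ.1ℤ
  n∸1≡n-1 = sym (ℤ.⊖-≥ (ℕ.≤-trans (ℕ.s≤s ℕ.z≤n) n≥2))
  a b : ℤ.ℤ → ℤ.ℤ
  a x = + n ℤ.* x ℤ.+ (+ n ℤ.- ℤ.1ℤ)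
  b x = + n ℤ.* x ℤ.+ ℤ.1ℤ
  B = ∏ p b
  conclude : Σ ℕ (λ r → p ≡ ℕ.suc (m ℕ.+ m) ℕ.+ (r ℕ.+ r)) →
    poch (1ℚ - (+ 1 / n)) p ≡ (+ (n ∸ 1) / 1) * poch (+ 1 / n) p [modPow p ^ 3 ]
  conclude (r , p≡1+2m+2r) =
    clear-denominator p 3 (n ℕ.^ p) (poch (1ℚ - + 1 / n) p) (ι (+ (n ∸ 1)) * poch (+ 1 / n) p)
      (∏ p a) ((+ n ℤ.- ℤ.1ℤ) ℤ.* B) (prime∤power p-prime (divisor-bound p-prime p≡1+nm) p)
      (poch-clear n (1ℚ - + 1 / n) a (clear-1-1/n n) p)
      (trans (scale-cleared (+ (n ∸ 1)) _ _ B (poch-clear n (+ 1 / n) b (clear-1/n n) p))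
             (cong (λ c → ι (c ℤ.* B)) n∸1≡n-1))
      (integer-congruence n m r p p≡1+2m+2r p≡1+nm)
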